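{- If $G=C_n$ is the cycle on $n\ge 4$ vertices, then $\mathrm{fpt}(G)=\left\lceil \frac{n-3}{2}\right\rceil$.
   Context: Zero forcing: given a set $B\subseteq V(G)$ of initially blue vertices (all others white), the color change rule allows a blue vertex $b$ to turn a white vertex $w$ blue if $w$ is the unique white neighbor of $b$. $B$ is a zero forcing set if repeated application eventually turns all of $V(G)$ blue. Propagation: set $B^{[0]}=B$ and for $i\ge1$ let $B^{(i)}$ be the set of vertices $u\notin B^{[i-1]}$ such that some $v\in B^{[i-1]}$ has $u$ as its unique neighbor outside $B^{[i-1]}$, and $B^{[i]}=B^{[i-1]}\cup B^{(i)}$; $\mathrm{pt}(G,B)$ is the least $k$ with $B^{[k]}=V(G)$. A set $B$ with $|B|=m\ge1$ is a fault tolerant zero forcing set if every $(m-1)$-subset of $B$ is a zero forcing set; $\mathrm{Z}_t(G)$ is the minimum size of such a set, and a fault tolerant zero forcing set of that size is called minimum. For a fault tolerant zero forcing set $B$, $\mathrm{fpt}(G,B)=\max_{b\in B}\mathrm{pt}(G,B\setminus\{b\})$, and $\mathrm{fpt}(G)=\min\{\mathrm{fpt}(G,B): B \text{ a minimum fault tolerant zero forcing set of } G\}$. -}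

module Defs where

open import Data.Nat using (ℕ; zero; suc; _≤_)
open import Data.Fin using (Fin; toℕ)
open import Data.Fin.Subset using (Subset; _∈_; _-_; ∣_∣)
open import Data.Product using (Σ; _×_; ∃)
open import Data.Sum using (_⊎_)
open import Relation.Nullary using (¬_)
open import Relation.Binary.PropositionalEquality using (_≡_)

record Graph (n : ℕ) : Set₁ where
  field
    _~_ : Fin n → Fin n → Set
open Graph public

-- The cycle C_n on vertices 0,…,n-1: i ~ j iff j = i ± 1 (mod n).
-- (For n ≥ 3 this is exactly the cycle graph.)
Cycle : (n : ℕ) → Graph n
Cycle n = record { _~_ = λ i j →
    (suc (toℕ i) ≡ toℕ j) ⊎ (suc (toℕ j) ≡ toℕ i)
  ⊎ ((toℕ i ≡ 0) × (suc (toℕ j) ≡ n)) ⊎ ((toℕ j ≡ 0) × (suc (toℕ i) ≡ n)) }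

-- Membership in B^[k] (vertices blue after k propagation rounds from B).
-- u ∈ B^(k+1) iff u ∉ B^[k] and some v ∈ B^[k] has u as its unique
-- neighbour outside B^[k].
Blue : ∀ {n} → Graph n → Subset n → ℕ → Fin n → Set
Blue G B zero u = u ∈ B
Blue G B (suc k) u =
  Blue G B k u ⊎
  ((¬ Blue G B k u) ×
   Σ (Fin _) λ v → Blue G B k v × (_~_ G v u) ×
     (∀ w → _~_ G v w → ¬ Blue G B k w → w ≡ u))

AllBlue : ∀ {n} → Graph n → Subset n → ℕ → Set
AllBlue G B k = ∀ u → Blue G B k u

IsZF : ∀ {n} → Graph n → Subset n → Set
IsZF G B = ∃ λ k → AllBlue G B k

IsPt : ∀ {n} → Graph n → Subset n → ℕ → Set
IsPt G B k = AllBlue G B k × (∀ j → AllBlue G B j → k ≤ j)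

-- B (with |B| = m ≥ 1) is a fault tolerant zero forcing set: every
-- (m-1)-subset of B, i.e. every B ∖ {b} with b ∈ B, is a zero forcing set.
IsFTZF : ∀ {n} → Graph n → Subset n → Set
IsFTZF G B = (1 ≤ ∣ B ∣) × (∀ b → b ∈ B → IsZF G (B - b))

IsMinFTZF : ∀ {n} → Graph n → Subset n → Set
IsMinFTZF G B = IsFTZF G B × (∀ B′ → IsFTZF G B′ → ∣ B ∣ ≤ ∣ B′ ∣)

IsFptSet : ∀ {n} → Graph n → Subset n → ℕ → Set
IsFptSet G B k =
  (∀ b → b ∈ B → ∃ λ p → IsPt G (B - b) p × p ≤ k) ×
  (∃ λ b → b ∈ B × IsPt G (B - b) k)

IsFpt : ∀ {n} → Graph n → ℕ → Set
IsFpt G k =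
  (∃ λ B → IsMinFTZF G B × IsFptSet G B k) ×
  (∀ B k′ → IsMinFTZF G B → IsFptSet G B k′ → k ≤ k′)

{-# OPTIONS --safe #-}
-- On a cycle a vertex with two white neighbours cannot force, so every zero forcing set
-- contains two adjacent vertices.  Hence a fault tolerant set B has at least four vertices:
-- if B = {b, x, x+1}, where x, x+1 is the pair left after deleting b, then deleting x forces
-- b = x+2 and deleting x+1 forces b = x-1, so the cycle would have length 3.  Four
-- consecutive vertices are fault tolerant: whichever one is deleted, five consecutive vertices
-- are blue after one round, and a blue arc grows by one vertex at each end per round.
-- Conversely, if only a, a+1 and one more vertex c start blue, the two fronts of the pair
-- advance one vertex per round and each gains at most one extra vertex by jumping over c, so
-- after k rounds at most 2k+3 vertices are blue.
module Submission where

open import Defs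
open import Data.Nat using (ℕ; zero; suc; _+_; _≤_; _<_; _∸_; ⌈_/2⌉; ⌊_/2⌋; z≤n; s≤s; _≤?_; _<?_; _≟_)
open import Data.Nat.DivMod using (_%_; m%n<n; m<n⇒m%n≡m; n%n≡0; m%n%n≡m%n; %-distribˡ-+; [m+n]%n≡m%n)
open import Data.Nat.Properties
open import Data.Fin using (Fin; toℕ; fromℕ; fromℕ<; inject₁) renaming (zero to fz; suc to fs)
open import Data.Fin.Properties using (toℕ-injective; toℕ<n; toℕ-fromℕ; toℕ-fromℕ<; toℕ-inject₁; any?; all?) renaming (_≟_ to _≟ᶠ_)
open import Data.Fin.Subset using (Subset; _∈_; _∉_; _-_; ∣_∣; ⁅_⁆; ⊥; inside; Nonempty)
open import Data.Vec using (_∷_; here; there)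
open import Data.Fin.Subset.Properties using (_∈?_; nonempty?; Empty-unique; ∣⊥∣≡0; ∉⊥; p─q─q≡p─q; p─q⊆p; x∈p⇒∣p-x∣<∣p∣; x∈p∧x≢y⇒x∈p-y)
open import Data.Product using (_×_; ∃; _,_; proj₁; proj₂)
open import Data.Sum using (_⊎_; inj₁; inj₂)
open import Relation.Binary using (Decidable)
open import Relation.Nullary using (¬_; Dec; yes; no; contradiction)
open import Relation.Nullary.Decidable using (_⊎-dec_; _×-dec_; _→-dec_; ¬?; decidable-stable)
open import Relation.Binary.PropositionalEquality using (_≡_; _≢_; ≢-sym; refl; sym; trans; cong; subst; module ≡-Reasoning)
open import Function using (_∘′_; id)
open import Data.Nat.Tactic.RingSolver using (solve-∀)

module ZeroForcing {n : ℕ} (G : Graph n) (_~?_ : Decidable (_~_ G)) where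

  open Graph G using () renaming (_~_ to _~ᴳ_)

  blue? : ∀ S k u → Dec (Blue G S k u)
  blue? S zero    u = u ∈? S
  blue? S (suc k) u =
    blue? S k u ⊎-dec (¬? (blue? S k u) ×-dec any? λ v →
      blue? S k v ×-dec (v ~? u) ×-dec all? λ w →
        (v ~? w) →-dec (¬? (blue? S k w) →-dec (w ≟ᶠ u)))

  force : ∀ {S k v u} → Blue G S k v → v ~ᴳ u → (∀ w → v ~ᴳ w → w ≢ u → Blue G S k w) →
          Blue G S (suc k) u
  force {S} {k} {v} {u} bv v~u others with blue? S k u
  ... | yes bu = inj₁ bu
  ... | no ¬bu = inj₂ (¬bu , v , bv , v~u , λ w v~w ¬bw →
                   decidable-stable (w ≟ᶠ u) λ w≢u → ¬bw (others w v~w w≢u))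

  blue-invariant : ∀ {S} (I : ℕ → Fin n → Set) →
    (∀ u → u ∈ S → I 0 u) →
    (∀ k u → I k u → I (suc k) u) →
    (∀ k v u → I k v → v ~ᴳ u → (∀ w → v ~ᴳ w → w ≢ u → I k w) → I (suc k) u) →
    ∀ k u → Blue G S k u → I k u
  blue-invariant I base mono forcing zero    u b        = base u b
  blue-invariant I base mono forcing (suc k) u (inj₁ b) = mono k u (blue-invariant I base mono forcing k u b)
  -- Decidability of Blue turns "every white neighbour of v is u" into "every neighbour of v
  -- other than u is blue".
  blue-invariant {S} I base mono forcing (suc k) u (inj₂ (_ , v , bv , v~u , unique)) =
    forcing k v u (invariant v bv) v~u λ w v~w w≢u →
      invariant w (decidable-stable (blue? S k w) λ ¬bw → w≢u (unique w v~w ¬bw))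
    where
    invariant : ∀ w → Blue G S k w → I k w
    invariant = blue-invariant I base mono forcing k

x∉p-x : ∀ {n} {p : Subset n} x → x ∉ p - x
x∉p-x {p = p} x x∈p-x =
  <-irrefl (cong ∣_∣ (p─q─q≡p─q p ⁅ x ⁆)) (x∈p⇒∣p-x∣<∣p∣ x∈p-x)

x∈p-y⇒x∈p×x≢y : ∀ {n} {p : Subset n} {x y} → x ∈ p - y → x ∈ p × x ≢ y
x∈p-y⇒x∈p×x≢y {p = p} {y = y} x∈ =
  p─q⊆p p ⁅ y ⁆ x∈ , λ { refl → x∉p-x y x∈ }

1≤∣p∣⇒nonempty : ∀ {n} {p : Subset n} → 1 ≤ ∣ p ∣ → Nonempty p
1≤∣p∣⇒nonempty {n} {p} 1≤∣p∣ with nonempty? p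
... | yes ne = ne
... | no ¬ne = contradiction (trans (cong ∣_∣ (Empty-unique ¬ne)) (∣⊥∣≡0 n)) (≢-sym (<⇒≢ 1≤∣p∣))

_⊆⟨_,_,_⟩ : ∀ {n} → Subset n → Fin n → Fin n → Fin n → Set
p ⊆⟨ a , b , c ⟩ = ∀ {y} → y ∈ p → y ≡ a ⊎ y ≡ b ⊎ y ≡ c

∣p∣≤3⇒⊆⟨⟩ : ∀ {n} {p : Subset n} {a b c} → ∣ p ∣ ≤ 3 → a ∈ p → b ∈ p → c ∈ p →
            a ≢ b → a ≢ c → b ≢ c → p ⊆⟨ a , b , c ⟩
∣p∣≤3⇒⊆⟨⟩ {n} {p} {a} {b} {c} ∣p∣≤3 a∈ b∈ c∈ a≢b a≢c b≢c {y} y∈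
  with y ≟ᶠ a | y ≟ᶠ b | y ≟ᶠ c
... | yes y≡a | _       | _       = inj₁ y≡a
... | no _    | yes y≡b | _       = inj₂ (inj₁ y≡b)
... | no _    | no _    | yes y≡c = inj₂ (inj₂ y≡c)
... | no y≢a  | no y≢b  | no y≢c  = contradiction (≤-trans four≤∣p∣ ∣p∣≤3) (<-irrefl refl)
  where
  grow : ∀ {k x} {q : Subset n} → x ∈ q → k ≤ ∣ q - x ∣ → suc k ≤ ∣ q ∣
  grow x∈q k≤ = ≤-trans (s≤s k≤) (x∈p⇒∣p-x∣<∣p∣ x∈q)
  four≤∣p∣ : 4 ≤ ∣ p ∣
  four≤∣p∣ =
    grow a∈ (grow (x∈p∧x≢y⇒x∈p-y b∈ (a≢b ∘′ sym))
      (grow (x∈p∧x≢y⇒x∈p-y (x∈p∧x≢y⇒x∈p-y c∈ (a≢c ∘′ sym)) (b≢c ∘′ sym))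
        (grow (x∈p∧x≢y⇒x∈p-y (x∈p∧x≢y⇒x∈p-y (x∈p∧x≢y⇒x∈p-y y∈ y≢a) y≢b) y≢c) z≤n)))

∣p∣≤3⇒⊆⟨a,b,_⟩ : ∀ {n} {p : Subset n} {a b} → ∣ p ∣ ≤ 3 → a ∈ p → b ∈ p → a ≢ b →
                 ∃ λ c → p ⊆⟨ a , b , c ⟩
∣p∣≤3⇒⊆⟨a,b,_⟩ {p = p} {a} {b} ∣p∣≤3 a∈ b∈ a≢b
  with any? (λ c → (c ∈? p) ×-dec ¬? (c ≟ᶠ a) ×-dec ¬? (c ≟ᶠ b))
... | yes (c , c∈ , c≢a , c≢b) =
  c , ∣p∣≤3⇒⊆⟨⟩ ∣p∣≤3 a∈ b∈ c∈ a≢b (c≢a ∘′ sym) (c≢b ∘′ sym)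
... | no ∄c = a , a-or-b
  where
  a-or-b : p ⊆⟨ a , b , a ⟩
  a-or-b {y} y∈ with y ≟ᶠ a | y ≟ᶠ b
  ... | yes y≡a | _       = inj₁ y≡a
  ... | no _    | yes y≡b = inj₂ (inj₁ y≡b)
  ... | no y≢a  | no y≢b  = contradiction (y , y∈ , y≢a , y≢b) ∄c

j<⌈n/2⌉⇒j+j<n : ∀ n {j} → j < ⌈ n /2⌉ → j + j < n
j<⌈n/2⌉⇒j+j<n (suc zero)    {zero}  _       = s≤s z≤n
j<⌈n/2⌉⇒j+j<n (suc zero)    {suc j} (s≤s ())
j<⌈n/2⌉⇒j+j<n (suc (suc n)) {zero}  _       = s≤s z≤n
j<⌈n/2⌉⇒j+j<n (suc (suc n)) {suc j} (s≤s j<) =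
  s≤s (s≤s (subst (_≤ n) (sym (+-suc j j)) (j<⌈n/2⌉⇒j+j<n n j<)))

n≤1+⌊n/2⌋+⌊n/2⌋ : ∀ n → n ≤ suc (⌊ n /2⌋ + ⌊ n /2⌋)
n≤1+⌊n/2⌋+⌊n/2⌋ zero          = z≤n
n≤1+⌊n/2⌋+⌊n/2⌋ (suc zero)    = s≤s z≤n
n≤1+⌊n/2⌋+⌊n/2⌋ (suc (suc n)) =
  s≤s (s≤s (subst (n ≤_) (sym (+-suc ⌊ n /2⌋ ⌊ n /2⌋)) (n≤1+⌊n/2⌋+⌊n/2⌋ n)))

module Cycle≥3 (n : ℕ) where

  N : ℕ
  N = suc (suc (suc n))

  C : Graph N
  C = Cycle N

  open Graph C using () renaming (_~_ to _~ᶜ_)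

  data Succ (x y : ℕ) : Set where
    step : suc x < N → suc x ≡ y → Succ x y
    wrap : suc x ≡ N → y ≡ 0 → Succ x y

  succ-functional : ∀ {x y y′} → Succ x y → Succ x y′ → y ≡ y′
  succ-functional (step _ refl) (step _ refl) = refl
  succ-functional (step x<N _)  (wrap x≡N _)  = contradiction x≡N (<⇒≢ x<N)
  succ-functional (wrap x≡N _)  (step x<N _)  = contradiction x≡N (<⇒≢ x<N)
  succ-functional (wrap _ refl) (wrap _ refl) = refl

  succ-injective : ∀ {x x′ y} → Succ x y → Succ x′ y → x ≡ x′
  succ-injective (step _ refl) (step _ e)    = suc-injective (sym e)
  succ-injective (step _ refl) (wrap _ ())
  succ-injective (wrap _ refl) (step _ ())
  succ-injective (wrap x≡N _)  (wrap x′≡N _) = suc-injective (trans x≡N (sym x′≡N))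

  succ-of-< : ∀ {x y} → suc x < N → Succ x y → y ≡ suc x
  succ-of-< _    (step _ refl) = refl
  succ-of-< x<N  (wrap x≡N _)  = contradiction x≡N (<⇒≢ x<N)

  succ-to-0 : ∀ {x} → Succ x 0 → suc x ≡ N
  succ-to-0 (wrap x≡N _) = x≡N

  succ-% : ∀ r → r < N → Succ r (suc r % N)
  succ-% r r<N with suc r <? N
  ... | yes r+1<N = step r+1<N (sym (m<n⇒m%n≡m r+1<N))
  ... | no  r+1≮N = wrap r+1≡N (trans (cong (_% N) r+1≡N) (n%n≡0 N))
    where
    r+1≡N : suc r ≡ N
    r+1≡N = ≤-antisym r<N (≮⇒≥ r+1≮N)

  next : Fin N → Fin N
  next v = fromℕ< (m%n<n (suc (toℕ v)) N)

  prev : Fin N → Fin N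
  prev fz     = fromℕ (suc (suc n))
  prev (fs v) = inject₁ v

  toℕ-next : ∀ v → toℕ (next v) ≡ suc (toℕ v) % N
  toℕ-next v = toℕ-fromℕ< (m%n<n (suc (toℕ v)) N)

  succ-next : ∀ v → Succ (toℕ v) (toℕ (next v))
  succ-next v = subst (Succ (toℕ v)) (sym (toℕ-next v)) (succ-% (toℕ v) (toℕ<n v))

  succ-prev : ∀ v → Succ (toℕ (prev v)) (toℕ v)
  succ-prev fz     = wrap (cong suc (toℕ-fromℕ _)) refl
  succ-prev (fs v) = step (subst (_< N) (sym v+1≡) (toℕ<n (fs v))) v+1≡
    where
    v+1≡ : suc (toℕ (inject₁ v)) ≡ suc (toℕ v)
    v+1≡ = cong suc (toℕ-inject₁ v)

  next-prev : ∀ v → next (prev v) ≡ v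
  next-prev v = toℕ-injective (succ-functional (succ-next (prev v)) (succ-prev v))

  prev-next : ∀ v → prev (next v) ≡ v
  prev-next v = toℕ-injective (succ-injective (succ-prev (next v)) (succ-next v))

  next-injective : ∀ {u v} → next u ≡ next v → u ≡ v
  next-injective {u} {v} e = trans (sym (prev-next u)) (trans (cong prev e) (prev-next v))

  adjacent⇒succ : ∀ {v u} → v ~ᶜ u → Succ (toℕ v) (toℕ u) ⊎ Succ (toℕ u) (toℕ v)
  adjacent⇒succ {v} {u} (inj₁ e)                   = inj₁ (step (subst (_< N) (sym e) (toℕ<n u)) e)
  adjacent⇒succ {v} {u} (inj₂ (inj₁ e))            = inj₂ (step (subst (_< N) (sym e) (toℕ<n v)) e)
  adjacent⇒succ (inj₂ (inj₂ (inj₁ (v≡0 , u≡N)))) = inj₂ (wrap u≡N v≡0)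
  adjacent⇒succ (inj₂ (inj₂ (inj₂ (u≡0 , v≡N)))) = inj₁ (wrap v≡N u≡0)

  succ⇒adjacent : ∀ {v u} → Succ (toℕ v) (toℕ u) → v ~ᶜ u
  succ⇒adjacent (step _ e)   = inj₁ e
  succ⇒adjacent (wrap e u≡0) = inj₂ (inj₂ (inj₂ (u≡0 , e)))

  succ⇒adjacentʳ : ∀ {v u} → Succ (toℕ v) (toℕ u) → u ~ᶜ v
  succ⇒adjacentʳ (step _ e)   = inj₂ (inj₁ e)
  succ⇒adjacentʳ (wrap e u≡0) = inj₂ (inj₂ (inj₁ (u≡0 , e)))

  next-adjacent : ∀ v → v ~ᶜ next v
  next-adjacent v = succ⇒adjacent (succ-next v)

  prev-adjacent : ∀ v → v ~ᶜ prev v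
  prev-adjacent v = succ⇒adjacentʳ (succ-prev v)

  neighbours : ∀ {v u} → v ~ᶜ u → u ≡ next v ⊎ u ≡ prev v
  neighbours {v} {u} v~u with adjacent⇒succ v~u
  ... | inj₁ s = inj₁ (toℕ-injective (succ-functional s (succ-next v)))
  ... | inj₂ s = inj₂ (toℕ-injective (succ-injective s (succ-prev v)))

  _~?_ : Decidable (_~_ C)
  v ~? u = (suc (toℕ v) ≟ toℕ u) ⊎-dec (suc (toℕ u) ≟ toℕ v)
    ⊎-dec ((toℕ v ≟ 0) ×-dec (suc (toℕ u) ≟ N)) ⊎-dec ((toℕ u ≟ 0) ×-dec (suc (toℕ v) ≟ N))

  [m%N+k]%N≡[m+k]%N : ∀ m k → (m % N + k) % N ≡ (m + k) % N
  [m%N+k]%N≡[m+k]%N m k = begin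
    (m % N + k) % N          ≡⟨ %-distribˡ-+ (m % N) k N ⟩
    (m % N % N + k % N) % N  ≡⟨ cong (λ r → (r + k % N) % N) (m%n%n≡m%n m N) ⟩
    (m % N + k % N) % N      ≡⟨ %-distribˡ-+ m k N ⟨
    (m + k) % N              ∎
    where open ≡-Reasoning

  [k+m%N]%N≡[k+m]%N : ∀ k m → (k + m % N) % N ≡ (k + m) % N
  [k+m%N]%N≡[k+m]%N k m = begin
    (k + m % N) % N  ≡⟨ cong (_% N) (+-comm k (m % N)) ⟩
    (m % N + k) % N  ≡⟨ [m%N+k]%N≡[m+k]%N m k ⟩
    (m + k) % N      ≡⟨ cong (_% N) (+-comm m k) ⟩
    (k + m) % N      ∎
    where open ≡-Reasoning

  _⊖_ : Fin N → Fin N → ℕ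
  u ⊖ a = (toℕ u + (N ∸ toℕ a)) % N

  _⊕_ : Fin N → ℕ → Fin N
  a ⊕ i = fromℕ< (m%n<n (toℕ a + i) N)

  toℕ-⊕ : ∀ a i → toℕ (a ⊕ i) ≡ (toℕ a + i) % N
  toℕ-⊕ a i = toℕ-fromℕ< (m%n<n (toℕ a + i) N)

  ⊖<N : ∀ u a → u ⊖ a < N
  ⊖<N u a = m%n<n (toℕ u + (N ∸ toℕ a)) N

  a+[N∸a]≡N : ∀ a → toℕ a + (N ∸ toℕ a) ≡ N
  a+[N∸a]≡N a = m+[n∸m]≡n (<⇒≤ (toℕ<n a))

  ⊖-self : ∀ a → a ⊖ a ≡ 0
  ⊖-self a = trans (cong (_% N) (a+[N∸a]≡N a)) (n%n≡0 N)

  ⊖-⊕ : ∀ a {i} → i < N → (a ⊕ i) ⊖ a ≡ i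
  ⊖-⊕ a {i} i<N = begin
    (toℕ (a ⊕ i) + (N ∸ toℕ a)) % N          ≡⟨ cong (λ t → (t + (N ∸ toℕ a)) % N) (toℕ-⊕ a i) ⟩
    ((toℕ a + i) % N + (N ∸ toℕ a)) % N      ≡⟨ [m%N+k]%N≡[m+k]%N (toℕ a + i) (N ∸ toℕ a) ⟩
    (toℕ a + i + (N ∸ toℕ a)) % N            ≡⟨ cong (_% N) (x+y+z≡y+[x+z] (toℕ a) i _) ⟩
    (i + (toℕ a + (N ∸ toℕ a))) % N          ≡⟨ cong (λ s → (i + s) % N) (a+[N∸a]≡N a) ⟩
    (i + N) % N                              ≡⟨ [m+n]%n≡m%n i N ⟩
    i % N                                    ≡⟨ m<n⇒m%n≡m i<N ⟩
    i                                        ∎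
    where
    open ≡-Reasoning
    x+y+z≡y+[x+z] : ∀ x y z → x + y + z ≡ y + (x + z)
    x+y+z≡y+[x+z] = solve-∀

  succ-⊖ : ∀ u a → Succ (u ⊖ a) (next u ⊖ a)
  succ-⊖ u a = subst (Succ (u ⊖ a)) r+1%N≡ (succ-% (u ⊖ a) (⊖<N u a))
    where
    open ≡-Reasoning
    c : ℕ
    c = N ∸ toℕ a
    r+1%N≡ : suc (u ⊖ a) % N ≡ next u ⊖ a
    r+1%N≡ = begin
      (1 + (toℕ u + c) % N) % N     ≡⟨ [k+m%N]%N≡[k+m]%N 1 (toℕ u + c) ⟩
      (suc (toℕ u) + c) % N         ≡⟨ [m%N+k]%N≡[m+k]%N (suc (toℕ u)) c ⟨
      (suc (toℕ u) % N + c) % N     ≡⟨ cong (λ t → (t + c) % N) (toℕ-next u) ⟨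
      (toℕ (next u) + c) % N        ∎

  succ-⊖-prev : ∀ u a → Succ (prev u ⊖ a) (u ⊖ a)
  succ-⊖-prev u a = subst (λ w → Succ (prev u ⊖ a) (w ⊖ a)) (next-prev u) (succ-⊖ (prev u) a)

  ⊖-next : ∀ u a {i} → u ⊖ a ≡ i → suc i < N → next u ⊖ a ≡ suc i
  ⊖-next u a refl i+1<N = succ-of-< i+1<N (succ-⊖ u a)

  next-⊖-self : ∀ v → next v ⊖ v ≡ 1
  next-⊖-self v = ⊖-next v v (⊖-self v) (s≤s (s≤s z≤n))

  next≢id : ∀ v → next v ≢ v
  next≢id v e = contradiction (trans (sym (next-⊖-self v)) (trans (cong (_⊖ v) e) (⊖-self v))) λ ()

  suc[prev-⊖-self]≡N : ∀ v → suc (prev v ⊖ v) ≡ N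
  suc[prev-⊖-self]≡N v = succ-to-0 (subst (Succ (prev v ⊖ v)) (⊖-self v) (succ-⊖-prev v v))

  next≢prev : ∀ v → next v ≢ prev v
  next≢prev v e = contradiction 2≡N λ ()
    where
    open ≡-Reasoning
    2≡N : 2 ≡ N
    2≡N = begin
      2                  ≡⟨ cong suc (next-⊖-self v) ⟨
      suc (next v ⊖ v)   ≡⟨ cong (λ w → suc (w ⊖ v)) e ⟩
      suc (prev v ⊖ v)   ≡⟨ suc[prev-⊖-self]≡N v ⟩
      N                  ∎

  open ZeroForcing C _~?_

  ≢next⇒≡prev : ∀ {v w} → v ~ᶜ w → w ≢ next v → w ≡ prev v
  ≢next⇒≡prev v~w w≢next with neighbours v~w
  ... | inj₁ w≡next = contradiction w≡next w≢next
  ... | inj₂ w≡prev = w≡prev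

  ≢prev⇒≡next : ∀ {v w} → v ~ᶜ w → w ≢ prev v → w ≡ next v
  ≢prev⇒≡next v~w w≢prev with neighbours v~w
  ... | inj₁ w≡next = w≡next
  ... | inj₂ w≡prev = contradiction w≡prev w≢prev

  force-next : ∀ {S k v} → Blue C S k (prev v) → Blue C S k v → Blue C S (suc k) (next v)
  force-next {S} {k} {v} bp bv = force bv (next-adjacent v) λ w v~w w≢next →
    subst (Blue C S k) (sym (≢next⇒≡prev v~w w≢next)) bp

  force-prev : ∀ {S k v} → Blue C S k (next v) → Blue C S k v → Blue C S (suc k) (prev v)
  force-prev {S} {k} {v} bn bv = force bv (prev-adjacent v) λ w v~w w≢prev →
    subst (Blue C S k) (sym (≢prev⇒≡next v~w w≢prev)) bn

  blue-invariantᶜ : ∀ {S} (I : ℕ → Fin N → Set) →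
    (∀ u → u ∈ S → I 0 u) →
    (∀ k u → I k u → I (suc k) u) →
    (∀ k v → I k (prev v) → I k v → I (suc k) (next v)) →
    (∀ k v → I k (next v) → I k v → I (suc k) (prev v)) →
    ∀ k u → Blue C S k u → I k u
  blue-invariantᶜ I base mono forward backward = blue-invariant I base mono forcing
    where
    forcing : ∀ k v u → I k v → v ~ᶜ u → (∀ w → v ~ᶜ w → w ≢ u → I k w) → I (suc k) u
    forcing k v u Iv v~u others with neighbours v~u
    ... | inj₁ refl = forward k v (others (prev v) (prev-adjacent v) (next≢prev v ∘′ sym)) Iv
    ... | inj₂ refl = backward k v (others (next v) (next-adjacent v) (next≢prev v)) Iv

  AdjacentPair : Subset N → Set
  AdjacentPair S = ∃ λ a → a ∈ S × next a ∈ S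

  all-blue⇒adjacent-pair : ∀ {S k} → AllBlue C S k → AdjacentPair S
  all-blue⇒adjacent-pair {S} {k} all-blue
    with in-S-or-pair k fz (all-blue fz) | in-S-or-pair k (next fz) (all-blue (next fz))
    where
    InSOrPair : ℕ → Fin N → Set
    InSOrPair _ u = u ∈ S ⊎ AdjacentPair S
    forward : ∀ k v → InSOrPair k (prev v) → InSOrPair k v → InSOrPair (suc k) (next v)
    forward _ v (inj₁ p∈S) (inj₁ v∈S) = inj₂ (prev v , p∈S , subst (_∈ S) (sym (next-prev v)) v∈S)
    forward _ _ (inj₂ pair) _          = inj₂ pair
    forward _ _ _          (inj₂ pair) = inj₂ pair
    backward : ∀ k v → InSOrPair k (next v) → InSOrPair k v → InSOrPair (suc k) (prev v)
    backward _ v (inj₁ n∈S) (inj₁ v∈S) = inj₂ (v , v∈S , n∈S)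
    backward _ _ (inj₂ pair) _          = inj₂ pair
    backward _ _ _          (inj₂ pair) = inj₂ pair
    in-S-or-pair : ∀ k u → Blue C S k u → InSOrPair k u
    in-S-or-pair = blue-invariantᶜ InSOrPair (λ _ → inj₁) (λ _ _ → id) forward backward
  ... | inj₁ 0∈S  | inj₁ 1∈S  = fz , 0∈S , 1∈S
  ... | inj₂ pair | _         = pair
  ... | _         | inj₂ pair = pair

  -- The arc of the vertices -G, …, 0, …, F (mod N).
  Arc : ℕ → ℕ → ℕ → Set
  Arc F G i = i ≤ F ⊎ N ≤ G + i

  arc? : ∀ F G i → Dec (Arc F G i)
  arc? F G i = (i ≤? F) ⊎-dec (N ≤? G + i)

  arc-covers : ∀ {F G} i → N ≤ suc (F + G) → Arc F G i
  arc-covers {F} {G} i N≤ with i ≤? F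
  ... | yes i≤F = inj₁ i≤F
  ... | no  i≰F = inj₂ (≤-trans N≤ (≤-trans (+-monoˡ-≤ G (≰⇒> i≰F)) (≤-reflexive (+-comm i G))))

  arc-boundary : ∀ {F G i} → Arc (suc F) (suc G) i → ¬ Arc F G i → i ≡ suc F ⊎ N ≡ suc (G + i)
  arc-boundary (inj₁ i≤1+F) ¬arc = inj₁ (≤-antisym i≤1+F (≰⇒> (¬arc ∘′ inj₁)))
  arc-boundary (inj₂ N≤)    ¬arc = inj₂ (≤-antisym N≤ (≰⇒> (¬arc ∘′ inj₂)))

  arc-ahead : ∀ {F G x y} → 1 ≤ F → Succ x y → Succ y (suc F) → Arc F G x × Arc F G y
  arc-ahead _  (step _ refl) (step _ refl) = inj₁ (n≤1+n _) , inj₁ ≤-refl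
  arc-ahead () (wrap _ refl) (step _ refl)

  arc-behind : ∀ {F G x y z} → 1 ≤ F → N ≡ suc (G + x) → Succ x y → Succ y z → Arc F G y × Arc F G z
  arc-behind {G = G} {x} _ N≡ (step _ refl) (step _ refl) =
    inj₂ N≤G+y , inj₂ (≤-trans N≤G+y (+-monoʳ-≤ G (n≤1+n _)))
    where
    N≤G+y : N ≤ G + suc x
    N≤G+y = ≤-reflexive (trans N≡ (sym (+-suc G x)))
  arc-behind {G = G} {x} _ N≡ (step _ refl) (wrap _ refl) =
    inj₂ (≤-reflexive (trans N≡ (sym (+-suc G x)))) , inj₁ z≤n
  arc-behind 1≤F _ (wrap _ refl) (step _ refl) = inj₁ z≤n , inj₁ 1≤F
  arc-behind _   _ (wrap _ refl) (wrap _ refl) = inj₁ z≤n , inj₁ z≤n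

  arc-grows : ∀ {S k F G} → 1 ≤ F → (∀ u → Arc F G (toℕ u) → Blue C S k u) →
              ∀ u → Arc (suc F) (suc G) (toℕ u) → Blue C S (suc k) u
  arc-grows {S} {k} {F} {G} 1≤F blue u arc with arc? F G (toℕ u)
  ... | yes arcᵤ = inj₁ (blue u arcᵤ)
  ... | no ¬arcᵤ with arc-boundary arc ¬arcᵤ
  ...   | inj₁ u≡1+F = subst (Blue C S (suc k)) (next-prev u)
            (force-next (blue (prev (prev u)) (proj₁ ends)) (blue (prev u) (proj₂ ends)))
    where
    ends : Arc F G (toℕ (prev (prev u))) × Arc F G (toℕ (prev u))
    ends = arc-ahead 1≤F (succ-prev (prev u)) (subst (Succ _) u≡1+F (succ-prev u))
  ...   | inj₂ N≡ = subst (Blue C S (suc k)) (prev-next u)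
            (force-prev (blue (next (next u)) (proj₂ ends)) (blue (next u) (proj₁ ends)))
    where
    ends : Arc F G (toℕ (next u)) × Arc F G (toℕ (next (next u)))
    ends = arc-behind 1≤F N≡ (succ-next u) (succ-next (next u))

  arc-spreads : ∀ {S k F G} d → 1 ≤ F → (∀ u → Arc F G (toℕ u) → Blue C S k u) →
                ∀ u → Arc (d + F) (d + G) (toℕ u) → Blue C S (d + k) u
  arc-spreads zero    _   blue = blue
  arc-spreads {F = F} (suc d) 1≤F blue = arc-grows (≤-trans 1≤F (m≤n+m F d)) (arc-spreads d 1≤F blue)

  arc⇒all-blue : ∀ {S k F G} d → 1 ≤ F → N ≤ suc ((d + F) + (d + G)) →
                 (∀ u → Arc F G (toℕ u) → Blue C S k u) → AllBlue C S (d + k)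
  arc⇒all-blue d 1≤F N≤ blue u = arc-spreads d 1≤F blue u (arc-covers (toℕ u) N≤)

  last-vertex : ∀ {u} → N ≤ suc (toℕ u) → u ≡ prev fz
  last-vertex {u} N≤ = toℕ-injective (trans (suc-injective (≤-antisym (toℕ<n u) N≤)) (sym (toℕ-fromℕ _)))

  -- The offsets from a of the vertices that may be blue after k rounds when only a, next a and
  -- the vertex c at offset e start blue.
  data Reach (e k i : ℕ) : Set where
    at-c          : i ≡ e → Reach e k i
    ahead         : i ≤ suc k → Reach e k i
    ahead-past-c  : e < i → i ≤ suc (suc k) → Reach e k i
    behind        : N ≤ i + k → Reach e k i
    behind-past-c : i < e → N ≤ suc (i + k) → Reach e k i

  reach-suc : ∀ {e k i} → Reach e k i → Reach e (suc k) i
  reach-suc (at-c i≡e)            = at-c i≡e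
  reach-suc (ahead i≤)            = ahead (m≤n⇒m≤1+n i≤)
  reach-suc (ahead-past-c e<i i≤) = ahead-past-c e<i (m≤n⇒m≤1+n i≤)
  reach-suc {k = k} {i} (behind N≤) = behind (≤-trans N≤ (+-monoʳ-≤ i (n≤1+n k)))
  reach-suc {k = k} {i} (behind-past-c i<e N≤) =
    behind-past-c i<e (≤-trans N≤ (s≤s (+-monoʳ-≤ i (n≤1+n k))))

  reach-next : ∀ {e k x y z} → Succ x y → Succ y z → Reach e k x → Reach e k y → Reach e (suc k) z
  reach-next (wrap _ refl) (step _ refl) _ _ = ahead (s≤s z≤n)
  reach-next _             (wrap _ refl) _ _ = ahead z≤n
  reach-next {e} {k} {x} (step _ refl) (step _ refl) rx ry = from-y ry
    where
    behind′ : N ≤ suc (suc (x + k)) → Reach e (suc k) (suc (suc x))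
    behind′ N≤ = behind (≤-trans N≤ (s≤s (s≤s (+-monoʳ-≤ x (n≤1+n k)))))
    from-x : suc x ≡ e → Reach e k x → Reach e (suc k) (suc (suc x))
    from-x x+1≡e (at-c x≡e)           = contradiction (trans x≡e (sym x+1≡e)) (<⇒≢ (n<1+n x))
    from-x x+1≡e (ahead x≤)           = ahead-past-c (s≤s (≤-reflexive (sym x+1≡e))) (s≤s (s≤s x≤))
    from-x x+1≡e (ahead-past-c e<x _) = contradiction (subst (_< x) (sym x+1≡e) e<x) (<-asym (n<1+n x))
    from-x _     (behind N≤)          = behind′ (≤-trans N≤ (≤-trans (n≤1+n _) (n≤1+n _)))
    from-x _     (behind-past-c _ N≤) = behind′ (≤-trans N≤ (n≤1+n _))
    from-y : Reach e k (suc x) → Reach e (suc k) (suc (suc x))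
    from-y (at-c x+1≡e)              = from-x x+1≡e rx
    from-y (ahead x+1≤)              = ahead (s≤s x+1≤)
    from-y (ahead-past-c e<x+1 x+1≤) = ahead-past-c (m<n⇒m<1+n e<x+1) (s≤s x+1≤)
    from-y (behind N≤)               = behind′ (≤-trans N≤ (n≤1+n _))
    from-y (behind-past-c _ N≤)      = behind′ N≤

  reach-prev : ∀ {e k x y z} → Succ x y → Succ y z → Reach e k y → Reach e k z → Reach e (suc k) x
  reach-prev {k = k} {x} (wrap x+1≡N _) _ _ _ =
    behind (subst (_≤ x + suc k) x+1≡N (subst (suc x ≤_) (sym (+-suc x k)) (s≤s (m≤m+n x k))))
  reach-prev {e} {k} {x} (step _ refl) y→z ry rz = from-y ry
    where
    x≤ : ∀ {i} → suc x ≤ i → x ≤ i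
    x≤ = ≤-trans (n≤1+n x)
    behind-past-c′ : x < e → N ≤ suc (suc (x + k)) → Reach e (suc k) x
    behind-past-c′ x<e N≤ = behind-past-c x<e (subst (N ≤_) (cong suc (sym (+-suc x k))) N≤)
    from-z : ∀ {z} → suc x ≡ e → Succ (suc x) z → Reach e k z → Reach e (suc k) x
    from-z x+1≡e (wrap x+2≡N _) _ =
      behind-past-c′ (subst (x <_) x+1≡e (n<1+n x))
        (subst (_≤ suc (suc (x + k))) x+2≡N (s≤s (s≤s (m≤m+n x k))))
    from-z x+1≡e (step _ refl) (at-c x+2≡e) =
      contradiction (trans x+1≡e (sym x+2≡e)) (<⇒≢ (n<1+n _))
    from-z _ (step _ refl) (ahead x+2≤)          = ahead (x≤ (≤-trans (n≤1+n _) (m≤n⇒m≤1+n x+2≤)))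
    from-z _ (step _ refl) (ahead-past-c _ x+2≤) = ahead (x≤ (≤-trans (n≤1+n _) x+2≤))
    from-z x+1≡e (step _ refl) (behind N≤) = behind-past-c′ (subst (x <_) x+1≡e (n<1+n x)) N≤
    from-z x+1≡e (step _ refl) (behind-past-c x+2<e _) =
      contradiction (subst (suc (suc x) <_) (sym x+1≡e) x+2<e) (<-asym (n<1+n _))
    from-y : Reach e k (suc x) → Reach e (suc k) x
    from-y (at-c x+1≡e)             = from-z x+1≡e y→z rz
    from-y (ahead x+1≤)             = ahead (x≤ (m≤n⇒m≤1+n x+1≤))
    from-y (ahead-past-c _ x+1≤)    = ahead (x≤ x+1≤)
    from-y (behind N≤)              = behind (subst (N ≤_) (sym (+-suc x k)) N≤)
    from-y (behind-past-c x+1<e N≤) = behind-past-c′ (<-trans (n<1+n x) x+1<e) N≤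

  reach-gap : ∀ e {j} → j + j < n → ∃ λ i → i < N × ¬ Reach e j i
  reach-gap e {j} 2j<n = gap (e ≤? suc (suc j))
    where
    j<n : j < n
    j<n = ≤-trans (s≤s (m≤m+n j j)) 2j<n
    N≰3+2j : ¬ N ≤ suc (suc (suc (j + j)))
    N≰3+2j N≤ = 1+n≰n (≤-trans 2j<n (≤-pred (≤-pred (≤-pred N≤))))
    gap : Dec (e ≤ suc (suc j)) → ∃ λ i → i < N × ¬ Reach e j i
    gap (yes e≤j+2) = suc (suc (suc j)) , s≤s (s≤s (s≤s j<n)) , unreachable
      where
      unreachable : ¬ Reach e j (suc (suc (suc j)))
      unreachable (at-c i≡e)            = 1+n≰n (subst (_≤ suc (suc j)) (sym i≡e) e≤j+2)
      unreachable (ahead i≤)            = 1+n≰n (≤-trans (n≤1+n _) i≤)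
      unreachable (ahead-past-c _ i≤)   = 1+n≰n i≤
      unreachable (behind N≤)           = N≰3+2j N≤
      unreachable (behind-past-c i<e _) = 1+n≰n (≤-trans (n≤1+n _) (≤-trans i<e e≤j+2))
    gap (no e≰j+2) = suc (suc j) , s≤s (s≤s (s≤s (<⇒≤ j<n))) , unreachable
      where
      unreachable : ¬ Reach e j (suc (suc j))
      unreachable (at-c i≡e)           = e≰j+2 (≤-reflexive (sym i≡e))
      unreachable (ahead i≤)           = 1+n≰n i≤
      unreachable (ahead-past-c e<i _) = e≰j+2 (<⇒≤ e<i)
      unreachable (behind N≤)          = N≰3+2j (≤-trans N≤ (n≤1+n _))
      unreachable (behind-past-c _ N≤) = N≰3+2j N≤

  blue⇒reach : ∀ {S a c} → S ⊆⟨ a , next a , c ⟩ → ∀ k u → Blue C S k u → Reach (c ⊖ a) k (u ⊖ a)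
  blue⇒reach {S} {a} {c} S⊆ =
    blue-invariantᶜ (λ k u → Reach (c ⊖ a) k (u ⊖ a)) base (λ _ _ → reach-suc)
      (λ _ v → reach-next (succ-⊖-prev v a) (succ-⊖ v a))
      (λ _ v r-next r-v → reach-prev (succ-⊖-prev v a) (succ-⊖ v a) r-v r-next)
    where
    base : ∀ u → u ∈ S → Reach (c ⊖ a) 0 (u ⊖ a)
    base u u∈S with S⊆ u∈S
    ... | inj₁ refl        = ahead (subst (_≤ 1) (sym (⊖-self a)) z≤n)
    ... | inj₂ (inj₁ refl) = ahead (≤-reflexive (next-⊖-self a))
    ... | inj₂ (inj₂ refl) = at-c refl

  pt-lower-bound : ∀ {S j} → ∣ S ∣ ≤ 3 → AllBlue C S j → ⌈ n /2⌉ ≤ j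
  pt-lower-bound {S} {j} ∣S∣≤3 all-blue = ≮⇒≥ λ j<⌈n/2⌉ →
    let a , a∈S , next-a∈S = all-blue⇒adjacent-pair all-blue
        c , S⊆ = ∣p∣≤3⇒⊆⟨a,b,_⟩ ∣S∣≤3 a∈S next-a∈S (next≢id a ∘′ sym)
        i , i<N , unreachable = reach-gap (c ⊖ a) (j<⌈n/2⌉⇒j+j<n n j<⌈n/2⌉)
    in unreachable (subst (Reach (c ⊖ a) j) (⊖-⊕ a i<N) (blue⇒reach S⊆ j (a ⊕ i) (all-blue (a ⊕ i))))

module Cycle≥4 (n : ℕ) where

  open Cycle≥3 (suc n)

  next³≢id : ∀ v → next (next (next v)) ≢ v
  next³≢id v e = contradiction (trans (sym offset³) (trans (cong (_⊖ v) e) (⊖-self v))) λ ()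
    where
    offset³ : next (next (next v)) ⊖ v ≡ 3
    offset³ = ⊖-next (next (next v)) v (⊖-next (next v) v (next-⊖-self v) (s≤s (s≤s (s≤s z≤n))))
                       (s≤s (s≤s (s≤s (s≤s z≤n))))

  ft⇒adjacent-pair-avoiding : ∀ {B} → IsFTZF C B → ∀ {b} → b ∈ B →
                              ∃ λ a → (a ∈ B × a ≢ b) × (next a ∈ B × next a ≢ b)
  ft⇒adjacent-pair-avoiding (_ , ft) {b} b∈B =
    let a , a∈ , next-a∈ = all-blue⇒adjacent-pair (proj₂ (ft b b∈B))
    in a , x∈p-y⇒x∈p×x≢y a∈ , x∈p-y⇒x∈p×x≢y next-a∈

  drop-first : ∀ {y a b c : Fin N} → y ≡ a ⊎ y ≡ b ⊎ y ≡ c → y ≢ a → y ≡ b ⊎ y ≡ c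
  drop-first (inj₁ y≡a) y≢a = contradiction y≡a y≢a
  drop-first (inj₂ y≡b∨c) _ = y≡b∨c

  adjacent-within : ∀ {y p q} → y ≡ p ⊎ y ≡ q → next y ≡ p ⊎ next y ≡ q →
                    (y ≡ p × next y ≡ q) ⊎ (y ≡ q × next y ≡ p)
  adjacent-within {y} (inj₁ y≡p) (inj₁ ny≡p) = contradiction (trans ny≡p (sym y≡p)) (next≢id y)
  adjacent-within     (inj₁ y≡p) (inj₂ ny≡q) = inj₁ (y≡p , ny≡q)
  adjacent-within     (inj₂ y≡q) (inj₁ ny≡p) = inj₂ (y≡q , ny≡p)
  adjacent-within {y} (inj₂ y≡q) (inj₂ ny≡q) = contradiction (trans ny≡q (sym y≡q)) (next≢id y)

  ft⇒4≤∣B∣ : ∀ {B} → IsFTZF C B → 4 ≤ ∣ B ∣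
  ft⇒4≤∣B∣ {B} ftB = ≮⇒≥ λ ∣B∣<4 →
    let ∣B∣≤3 = ≤-pred ∣B∣<4
        b , b∈ = 1≤∣p∣⇒nonempty (proj₁ ftB)
        x , (x∈ , x≢b) , (nx∈ , nx≢b) = ft⇒adjacent-pair-avoiding ftB b∈
        y , (y∈ , y≢x) , (ny∈ , ny≢x) = ft⇒adjacent-pair-avoiding ftB x∈
        z , (z∈ , z≢nx) , (nz∈ , nz≢nx) = ft⇒adjacent-pair-avoiding ftB nx∈
        B⊆⟨x,b,nx⟩ = ∣p∣≤3⇒⊆⟨⟩ ∣B∣≤3 x∈ b∈ nx∈ x≢b (next≢id x ∘′ sym) (nx≢b ∘′ sym)
        B⊆⟨nx,b,x⟩ = ∣p∣≤3⇒⊆⟨⟩ ∣B∣≤3 nx∈ b∈ x∈ nx≢b (next≢id x) (x≢b ∘′ sym)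
        b≡nnx = b≡next²x y≢x (adjacent-within (drop-first (B⊆⟨x,b,nx⟩ y∈) y≢x)
                                              (drop-first (B⊆⟨x,b,nx⟩ ny∈) ny≢x))
    in no-pair-avoiding-next-x b≡nnx nx≢b
         (adjacent-within (drop-first (B⊆⟨nx,b,x⟩ z∈) z≢nx) (drop-first (B⊆⟨nx,b,x⟩ nz∈) nz≢nx))
    where
    b≡next²x : ∀ {x y b} → y ≢ x → (y ≡ b × next y ≡ next x) ⊎ (y ≡ next x × next y ≡ b) →
               b ≡ next (next x)
    b≡next²x y≢x (inj₁ (_ , ny≡nx))     = contradiction (next-injective ny≡nx) y≢x
    b≡next²x _   (inj₂ (y≡nx , ny≡b))   = trans (sym ny≡b) (cong next y≡nx)
    no-pair-avoiding-next-x : ∀ {x z b} → b ≡ next (next x) → next x ≢ b →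
                              ¬ ((z ≡ b × next z ≡ x) ⊎ (z ≡ x × next z ≡ b))
    no-pair-avoiding-next-x {x} b≡nnx _ (inj₁ (z≡b , nz≡x)) =
      next³≢id x (trans (cong next (trans (sym b≡nnx) (sym z≡b))) nz≡x)
    no-pair-avoiding-next-x _ nx≢b (inj₂ (z≡x , nz≡b)) = nx≢b (trans (cong next (sym z≡x)) nz≡b)

  pattern v₀ = fz
  pattern v₁ = fs v₀
  pattern v₂ = fs v₁
  pattern v₃ = fs v₂
  pattern v₄ = fs v₃

  B₄ : Subset N
  B₄ = inside ∷ inside ∷ inside ∷ inside ∷ ⊥

  ∣B₄∣≡4 : ∣ B₄ ∣ ≡ 4
  ∣B₄∣≡4 = cong (4 +_) (∣⊥∣≡0 n)

  arc-at-1⇒all-blue : ∀ {S} F G → F + G ≡ 4 → 1 ≤ F → (∀ u → Arc F G (toℕ u) → Blue C S 1 u) →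
                      AllBlue C S ⌈ suc n /2⌉
  arc-at-1⇒all-blue {S} F G F+G≡4 1≤F arc =
    subst (AllBlue C S) (+-comm d 1) (arc⇒all-blue d 1≤F N≤grown-arc arc)
    where
    open ≤-Reasoning
    d : ℕ
    d = ⌊ n /2⌋
    rearrange : ∀ F G d → (F + G) + (d + d) ≡ (d + F) + (d + G)
    rearrange = solve-∀
    N≤grown-arc : N ≤ suc ((d + F) + (d + G))
    N≤grown-arc = begin
      4 + n                    ≤⟨ +-monoʳ-≤ 4 (n≤1+⌊n/2⌋+⌊n/2⌋ n) ⟩
      suc (4 + (d + d))        ≡⟨ cong (λ s → suc (s + (d + d))) F+G≡4 ⟨
      suc ((F + G) + (d + d))  ≡⟨ cong suc (rearrange F G d) ⟩
      suc ((d + F) + (d + G))  ∎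

  arc-B₄-0 : ∀ u → Arc 4 0 (toℕ u) → Blue C (B₄ - v₀) 1 u
  arc-B₄-0 v₀ _ = force-prev {v = v₁} (there (there here)) (there here)
  arc-B₄-0 v₁ _ = inj₁ (there here)
  arc-B₄-0 v₂ _ = inj₁ (there (there here))
  arc-B₄-0 v₃ _ = inj₁ (there (there (there here)))
  arc-B₄-0 v₄ _ = force-next {v = v₃} (there (there here)) (there (there (there here)))
  arc-B₄-0 (fs (fs (fs (fs (fs _))))) (inj₁ (s≤s (s≤s (s≤s (s≤s ())))))
  arc-B₄-0 u (inj₂ N≤u) = contradiction N≤u (<⇒≱ (toℕ<n u))

  arc-B₄-1 : ∀ u → Arc 4 0 (toℕ u) → Blue C (B₄ - v₁) 1 u
  arc-B₄-1 v₀ _ = inj₁ here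
  arc-B₄-1 v₁ _ = force-prev {v = v₂} (there (there (there here))) (there (there here))
  arc-B₄-1 v₂ _ = inj₁ (there (there here))
  arc-B₄-1 v₃ _ = inj₁ (there (there (there here)))
  arc-B₄-1 v₄ _ = force-next {v = v₃} (there (there here)) (there (there (there here)))
  arc-B₄-1 (fs (fs (fs (fs (fs _))))) (inj₁ (s≤s (s≤s (s≤s (s≤s ())))))
  arc-B₄-1 u (inj₂ N≤u) = contradiction N≤u (<⇒≱ (toℕ<n u))

  arc-B₄-2 : ∀ u → Arc 3 1 (toℕ u) → Blue C (B₄ - v₂) 1 u
  arc-B₄-2 v₀ _ = inj₁ here
  arc-B₄-2 v₁ _ = inj₁ (there here)
  arc-B₄-2 v₂ _ = force-next {v = v₁} here (there here)
  arc-B₄-2 v₃ _ = inj₁ (there (there (there here)))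
  arc-B₄-2 (fs (fs (fs (fs _)))) (inj₁ (s≤s (s≤s (s≤s ()))))
  arc-B₄-2 u (inj₂ N≤1+u) =
    subst (Blue C _ 1) (sym (last-vertex N≤1+u)) (force-prev {v = v₀} (there here) here)

  arc-B₄-3 : ∀ u → Arc 3 1 (toℕ u) → Blue C (B₄ - v₃) 1 u
  arc-B₄-3 v₀ _ = inj₁ here
  arc-B₄-3 v₁ _ = inj₁ (there here)
  arc-B₄-3 v₂ _ = inj₁ (there (there here))
  arc-B₄-3 v₃ _ = force-next {v = v₂} (there here) (there (there here))
  arc-B₄-3 (fs (fs (fs (fs _)))) (inj₁ (s≤s (s≤s (s≤s ()))))
  arc-B₄-3 u (inj₂ N≤1+u) =
    subst (Blue C _ 1) (sym (last-vertex N≤1+u)) (force-prev {v = v₀} (there here) here)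

  B₄-all-blue : ∀ b → b ∈ B₄ → AllBlue C (B₄ - b) ⌈ suc n /2⌉
  B₄-all-blue v₀ _ = arc-at-1⇒all-blue 4 0 refl (s≤s z≤n) arc-B₄-0
  B₄-all-blue v₁ _ = arc-at-1⇒all-blue 4 0 refl (s≤s z≤n) arc-B₄-1
  B₄-all-blue v₂ _ = arc-at-1⇒all-blue 3 1 refl (s≤s z≤n) arc-B₄-2
  B₄-all-blue v₃ _ = arc-at-1⇒all-blue 3 1 refl (s≤s z≤n) arc-B₄-3
  B₄-all-blue (fs (fs (fs (fs b)))) (there (there (there (there b∈⊥)))) = contradiction b∈⊥ ∉⊥

  pt-lower-bound-∣B∣≤4 : ∀ {B b j} → b ∈ B → ∣ B ∣ ≤ 4 → AllBlue C (B - b) j → ⌈ suc n /2⌉ ≤ j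
  pt-lower-bound-∣B∣≤4 b∈B ∣B∣≤4 =
    pt-lower-bound (≤-pred (≤-trans (x∈p⇒∣p-x∣<∣p∣ b∈B) ∣B∣≤4))

  B₄-pt : ∀ {b} → b ∈ B₄ → IsPt C (B₄ - b) ⌈ suc n /2⌉
  B₄-pt {b} b∈ = B₄-all-blue b b∈ , λ j → pt-lower-bound-∣B∣≤4 b∈ (≤-reflexive ∣B₄∣≡4)

  B₄-ft : IsFTZF C B₄
  B₄-ft = s≤s z≤n , λ b b∈ → ⌈ suc n /2⌉ , B₄-all-blue b b∈

  B₄-min : IsMinFTZF C B₄
  B₄-min = B₄-ft , λ B ftB → subst (_≤ ∣ B ∣) (sym ∣B₄∣≡4) (ft⇒4≤∣B∣ ftB)

proposition5p7 : ∀ (n : ℕ) → 4 ≤ n → IsFpt (Cycle n) ⌈ n ∸ 3 /2⌉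
proposition5p7 _ (s≤s (s≤s (s≤s (s≤s {n = n} z≤n)))) =
  (B₄ , B₄-min , (λ b b∈ → ⌈ suc n /2⌉ , B₄-pt b∈ , ≤-refl) , (v₀ , here , B₄-pt here)) ,
  λ { B _ (_ , minimal) (_ , b , b∈ , (all-blue , _)) →
        pt-lower-bound-∣B∣≤4 b∈ (subst (∣ B ∣ ≤_) ∣B₄∣≡4 (minimal B₄ B₄-ft)) all-blue }
  where open Cycle≥4 n
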